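{- Let $P$ be a finite poset and $P^*$ its dual. If $I\in\mathcal{IC}(P)$ then $I\in\mathcal{IC}(P^*)$ and $t_x(I)=t^*_x(I)$ for every $x\in P$. Moreover $\mathrm{Row}_P^{ -1}(I)=\mathrm{Row}_{P^*}(I)$ for all $I\in\mathcal{IC}(P)$.
   Context: A subset $I\subseteq P$ is interval-closed if whenever $x,y\in I$ and $x\le z\le y$, then $z\in I$; $\mathcal{IC}(P)$ is the set of interval-closed subsets. The dual $P^*$ has the same elements with the reversed order. For $x\in P$, the toggle $t_x:\mathcal{IC}(P)\to\mathcal{IC}(P)$ sends $I$ to $I\triangle\{x\}$ if this set is interval-closed in $P$, and to $I$ otherwise; $t^*_x$ is the analogous toggle on $\mathcal{IC}(P^*)$. Rowmotion $\mathrm{Row}_P=t_{x_1}\circ\cdots\circ t_{x_N}$ for a linear extension $(x_1,\dots,x_N)$ of $P$ (independent of the choice), and $\mathrm{Row}_{P^*}$ is defined likewise using $P^*$ and the toggles $t^*_x$. -}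

module Defs where

open import Level using (0ℓ)
open import Data.Nat using (ℕ)
open import Data.Bool using (Bool; not)
open import Data.Fin using (Fin) renaming (_≤_ to _≤ᶠ_)
open import Data.Fin.Properties using (all?)
open import Data.Fin.Subset using (Subset; _∈_)
open import Data.Fin.Subset.Properties using (_∈?_)
open import Data.Vec using (_[_]%=_)
open import Data.List using (List; foldr; map; allFin)
open import Function using (flip)
open import Function.Definitions using (Bijective)
open import Relation.Binary.PropositionalEquality using (_≡_)
open import Relation.Binary.Structures using (IsPartialOrder)
open import Relation.Binary.Definitions using (Decidable)
open import Relation.Binary.Properties.Poset using ()
open import Relation.Nullary using (Dec; yes; no; _→-dec_)

record FinPoset : Set₁ where
  field
    n    : ℕ
    _≼_  : Fin n → Fin n → Set
    isPartialOrder : IsPartialOrder _≡_ _≼_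
    _≼?_ : Decidable _≼_

open FinPoset public

dual : FinPoset → FinPoset
dual P = record
  { n = n P
  ; _≼_ = flip (_≼_ P)
  ; isPartialOrder = IsPartialOrder-flip
  ; _≼?_ = λ x y → _≼?_ P y x
  }
  where
  open import Relation.Binary.Properties.Poset using ()
  open import Relation.Binary.Construct.Flip.EqAndOrd using () renaming (isPartialOrder to flipPO)
  IsPartialOrder-flip = flipPO (isPartialOrder P)

IsIC : (P : FinPoset) → Subset (n P) → Set
IsIC P I = ∀ x y z → x ∈ I → y ∈ I → _≼_ P x z → _≼_ P z y → z ∈ I

isIC? : (P : FinPoset) (I : Subset (n P)) → Dec (IsIC P I)
isIC? P I = all? λ x → all? λ y → all? λ z →
  (x ∈? I) →-dec ((y ∈? I) →-dec ((_≼?_ P x z) →-dec ((_≼?_ P z y) →-dec (z ∈? I))))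

symDiff1 : ∀ {m} → Fin m → Subset m → Subset m
symDiff1 x I = I [ x ]%= not

toggle : (P : FinPoset) → Fin (n P) → Subset (n P) → Subset (n P)
toggle P x I with isIC? P (symDiff1 x I)
... | yes _ = symDiff1 x I
... | no  _ = I

record LinearExtension (P : FinPoset) : Set where
  field
    enum : Fin (n P) → Fin (n P)
    bij  : Bijective _≡_ _≡_ enum
    mono : ∀ i j → _≼_ P (enum i) (enum j) → i ≤ᶠ j

open LinearExtension public

-- Row_P = t_{x₁} ∘ t_{x₂} ∘ ⋯ ∘ t_{x_N}  (t_{x_N} is applied first).
Row : (P : FinPoset) → LinearExtension P → Subset (n P) → Subset (n P)
Row P L I = foldr (toggle P) I (map (enum L) (allFin (n P)))

-- Interval-closedness is self-dual, and t_x only asks whether I △ {x} is interval-closed,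
-- so t_x = t*_x. The toggles are involutions of IC(P), and t_x, t_y commute when x and y are
-- incomparable: a chain u ≤ z ≤ v cannot meet both x and y, so the convexity of I △ {x} △ {y}
-- on it is inherited from I △ {x} or from I △ {y}. Hence all enumerations of P that are linear
-- extensions of P* compose their toggles to the same map on IC(P). A linear extension of P*
-- and the reverse of one of P are two such enumerations, so Row_{P*} applies the toggles of
-- Row_P in the opposite order, which undoes Row_P.
module Submission where

open import Defs
open import Data.Product using (_×_; _,_; proj₁; proj₂; swap)
open import Data.Sum as Sum using (_⊎_; inj₁; inj₂)
open import Data.Empty using (⊥-elim)
open import Data.Bool.Properties using (not-involutive)
open import Data.Fin using (Fin; _≟_)
open import Data.Fin.Subset using (Subset; _∈_)
open import Data.List using (List; []; _∷_; _++_; [_]; foldr; map; allFin; reverse; tabulate)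
open import Data.List.Properties
  using (foldr-++; foldr-∷ʳ; foldr-cong; ++-assoc; unfold-reverse; reverse-involutive; map-tabulate)
open import Data.List.Relation.Unary.All as All using (All; []; _∷_)
import Data.List.Relation.Unary.All.Properties as All
open import Data.List.Relation.Unary.Any using (here; there)
import Data.List.Relation.Unary.Any.Properties as Any
open import Data.List.Relation.Unary.AllPairs using (AllPairs; []; _∷_)
import Data.List.Relation.Unary.AllPairs.Properties as AllPairs
open import Data.List.Membership.Propositional using () renaming (_∈_ to _∈ₗ_; _∉_ to _∉ₗ_)
open import Data.List.Membership.Propositional.Properties using (∈-∃++; ∈-++⁺ˡ; ∈-++⁺ʳ; ∈-++⁻; ∈-tabulate⁺)
open import Data.List.Relation.Binary.Subset.Propositional using (_⊆_)
open import Data.Vec.Properties using (updateAt-updateAt-local; updateAt-id; updateAt-minimal; updateAt-commutes)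
open import Data.Nat.Properties using (<⇒≱)
open import Function using (_∘_)
open import Relation.Binary.PropositionalEquality using (_≡_; _≢_; refl; sym; trans; cong; subst; module ≡-Reasoning)
open import Relation.Binary.Structures using (IsPartialOrder)
open import Relation.Nullary using (¬_; Dec; yes; no)

Incomparable : {X : Set} → (X → X → Set) → X → X → Set
Incomparable _≤_ x y = ¬ x ≤ y × ¬ y ≤ x

module PartiallyCommutingInvolutions
  {X S : Set} (_≤_ : X → X → Set) (≤-refl : ∀ {x} → x ≤ x)
  (Inv : S → Set) (t : X → S → S)
  (t-preserves-Inv : ∀ x {J} → Inv J → Inv (t x J))
  (t-involutive : ∀ x {J} → Inv J → t x (t x J) ≡ J)
  (t-comm : ∀ {x y J} → Inv J → Incomparable _≤_ x y → t x (t y J) ≡ t y (t x J))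
  where

  open ≡-Reasoning

  Descending : List X → Set
  Descending = AllPairs (λ a b → ¬ a ≤ b)

  foldr-preserves-Inv : ∀ {J} xs → Inv J → Inv (foldr t J xs)
  foldr-preserves-Inv []       inv = inv
  foldr-preserves-Inv (x ∷ xs) inv = t-preserves-Inv x (foldr-preserves-Inv xs inv)

  foldr-++-reverse : ∀ xs {J} → Inv J → foldr t J (xs ++ reverse xs) ≡ J
  foldr-++-reverse []       inv = refl
  foldr-++-reverse (x ∷ xs) {J} inv = begin
    t x (foldr t J (xs ++ reverse (x ∷ xs)))    ≡⟨ cong (t x ∘ foldr t J ∘ (xs ++_)) (unfold-reverse x xs) ⟩
    t x (foldr t J (xs ++ (reverse xs ++ [ x ]))) ≡⟨ cong (t x ∘ foldr t J) (++-assoc xs (reverse xs) [ x ]) ⟨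
    t x (foldr t J ((xs ++ reverse xs) ++ [ x ])) ≡⟨ cong (t x) (foldr-∷ʳ t J x (xs ++ reverse xs)) ⟩
    t x (foldr t (t x J) (xs ++ reverse xs))      ≡⟨ cong (t x) (foldr-++-reverse xs (t-preserves-Inv x inv)) ⟩
    t x (t x J)                                   ≡⟨ t-involutive x inv ⟩
    J                                             ∎

  foldr-t-comm : ∀ a ys {J} → Inv J → All (Incomparable _≤_ a) ys →
    foldr t (t a J) ys ≡ t a (foldr t J ys)
  foldr-t-comm a []       inv []           = refl
  foldr-t-comm a (y ∷ ys) inv (a∥y ∷ a∥ys) =
    trans (cong (t y) (foldr-t-comm a ys inv a∥ys))
          (t-comm (foldr-preserves-Inv ys inv) (swap a∥y))

  Descending-remove : ∀ a xs ys → Descending (xs ++ a ∷ ys) →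
    Descending (xs ++ ys) × All (λ x → ¬ x ≤ a) xs × All (λ y → ¬ a ≤ y) ys
  Descending-remove a []       ys (a≰ys ∷ desc) = desc , [] , a≰ys
  Descending-remove a (x ∷ xs) ys (x≰ ∷ desc) with Descending-remove a xs ys desc | All.++⁻ xs x≰
  ... | desc′ , xs≰a , a≰ys | x≰xs , x≰a ∷ x≰ys = (All.++⁺ x≰xs x≰ys ∷ desc′) , (x≰a ∷ xs≰a) , a≰ys

  ≰⇒≢ : ∀ {x y} → ¬ x ≤ y → x ≢ y
  ≰⇒≢ x≰y refl = x≰y ≤-refl

  ∈-tail : ∀ {x a} {xs : List X} → x ≢ a → x ∈ₗ a ∷ xs → x ∈ₗ xs
  ∈-tail x≢a (here x≡a) = ⊥-elim (x≢a x≡a)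
  ∈-tail x≢a (there x∈) = x∈

  -- The head a of l sits in m = xs ++ a ∷ ys; everything in xs lies after a in l and
  -- before it in m, hence is incomparable to a, and t a can be moved past it.
  foldr-Descending-unique : ∀ l m → Descending l → Descending m → l ⊆ m → m ⊆ l →
    ∀ {J} → Inv J → foldr t J l ≡ foldr t J m
  foldr-Descending-unique []      []      _ _ _ _ inv = refl
  foldr-Descending-unique []      (b ∷ m) _ _ _ m⊆l inv with () ← m⊆l (here refl)
  foldr-Descending-unique (a ∷ l) m (a≰l ∷ desc-l) desc-m l⊆m m⊆l {J} inv
    with ∈-∃++ (l⊆m (here refl))
  ... | xs , ys , refl with Descending-remove a xs ys desc-m
  ... | desc-xs++ys , xs≰a , a≰ys = begin
    t a (foldr t J l)                   ≡⟨ cong (t a) (foldr-Descending-unique l (xs ++ ys)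
                                             desc-l desc-xs++ys l⊆xs++ys xs++ys⊆l inv) ⟩
    t a (foldr t J (xs ++ ys))          ≡⟨ cong (t a) (foldr-++ t J xs ys) ⟩
    t a (foldr t (foldr t J ys) xs)     ≡⟨ foldr-t-comm a xs (foldr-preserves-Inv ys inv) a∥xs ⟨
    foldr t (foldr t J (a ∷ ys)) xs     ≡⟨ foldr-++ t J xs (a ∷ ys) ⟨
    foldr t J (xs ++ a ∷ ys)            ∎
    where
    xs⊆l : xs ⊆ l
    xs⊆l {x} x∈ = ∈-tail (≰⇒≢ (All.lookup xs≰a x∈)) (m⊆l (∈-++⁺ˡ x∈))
    a∥xs : All (Incomparable _≤_ a) xs
    a∥xs = All.tabulate λ x∈ → All.lookup a≰l (xs⊆l x∈) , All.lookup xs≰a x∈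
    l⊆xs++ys : l ⊆ xs ++ ys
    l⊆xs++ys {x} x∈ with ∈-++⁻ xs (l⊆m (there x∈))
    ... | inj₁ x∈xs         = ∈-++⁺ˡ x∈xs
    ... | inj₂ (here x≡a)   = ⊥-elim (≰⇒≢ (All.lookup a≰l x∈) (sym x≡a))
    ... | inj₂ (there x∈ys) = ∈-++⁺ʳ xs x∈ys
    xs++ys⊆l : xs ++ ys ⊆ l
    xs++ys⊆l {x} x∈ with ∈-++⁻ xs x∈
    ... | inj₁ x∈xs = xs⊆l x∈xs
    ... | inj₂ x∈ys =
      ∈-tail (λ x≡a → ≰⇒≢ (All.lookup a≰ys x∈ys) (sym x≡a)) (m⊆l (∈-++⁺ʳ xs (there x∈ys)))

symDiff1-involutive : ∀ {m} (x : Fin m) S → symDiff1 x (symDiff1 x S) ≡ S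
symDiff1-involutive x S = trans (updateAt-updateAt-local x S (not-involutive _)) (updateAt-id x S)

symDiff1-comm : ∀ {m} {x y : Fin m} S → x ≢ y → symDiff1 x (symDiff1 y S) ≡ symDiff1 y (symDiff1 x S)
symDiff1-comm {x = x} {y} S x≢y = updateAt-commutes x y x≢y S

∈-symDiff1⁺ : ∀ {m} {w x : Fin m} {S} → w ≢ x → w ∈ S → w ∈ symDiff1 x S
∈-symDiff1⁺ {w = w} {x} {S} = updateAt-minimal w x S

∈-symDiff1⁻ : ∀ {m} {w x : Fin m} {S} → w ≢ x → w ∈ symDiff1 x S → w ∈ S
∈-symDiff1⁻ {w = w} {x} {S} w≢x w∈ = subst (w ∈_) (symDiff1-involutive x S) (∈-symDiff1⁺ w≢x w∈)

IsIC-dual : ∀ {P S} → IsIC P S → IsIC (dual P) S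
IsIC-dual ic x y z x∈ y∈ x≥z z≥y = ic y x z y∈ x∈ z≥y x≥z

toggle-dual : ∀ P x J → toggle P x J ≡ toggle (dual P) x J
toggle-dual P x J with isIC? P (symDiff1 x J) | isIC? (dual P) (symDiff1 x J)
... | yes _  | yes _  = refl
... | no  _  | no  _  = refl
... | yes ic | no ¬ic = ⊥-elim (¬ic (IsIC-dual {P} ic))
... | no ¬ic | yes ic = ⊥-elim (¬ic (IsIC-dual {dual P} ic))

module Toggles (P : FinPoset) where

  private
    _≤_ = _≼_ P
    module ≤ = IsPartialOrder (isPartialOrder P)
    IC = IsIC P
    t = toggle P
    infixl 6 _△_
    _△_ : Subset (n P) → Fin (n P) → Subset (n P)
    J △ x = symDiff1 x J

  open import Data.List.Membership.DecPropositional (_≟_ {n P}) using () renaming (_∈?_ to _∈ₗ?_)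

  toggle-accept : ∀ x J → IC (J △ x) → t x J ≡ J △ x
  toggle-accept x J ic with isIC? P (J △ x)
  ... | yes _   = refl
  ... | no ¬ic = ⊥-elim (¬ic ic)

  toggle-reject : ∀ x J → ¬ IC (J △ x) → t x J ≡ J
  toggle-reject x J ¬ic with isIC? P (J △ x)
  ... | yes ic = ⊥-elim (¬ic ic)
  ... | no _   = refl

  toggle-preserves-IC : ∀ x {J} → IC J → IC (t x J)
  toggle-preserves-IC x {J} ic with isIC? P (J △ x)
  ... | yes ic′ = ic′
  ... | no _    = ic

  toggle-involutive : ∀ x {J} → IC J → t x (t x J) ≡ J
  toggle-involutive x {J} ic with isIC? P (J △ x)
  ... | yes ic′ = trans (toggle-accept x (J △ x) (subst IC (sym (symDiff1-involutive x J)) ic))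
                        (symDiff1-involutive x J)
  ... | no ¬ic  = toggle-reject x J ¬ic

  chain-comparable : ∀ {u z v x y} → u ≤ z → z ≤ v →
    x ∈ₗ u ∷ z ∷ v ∷ [] → y ∈ₗ u ∷ z ∷ v ∷ [] → x ≤ y ⊎ y ≤ x
  chain-comparable u≤z z≤v (here refl)                 (here refl)                 = inj₁ ≤.refl
  chain-comparable u≤z z≤v (here refl)                 (there (here refl))         = inj₁ u≤z
  chain-comparable u≤z z≤v (here refl)                 (there (there (here refl))) = inj₁ (≤.trans u≤z z≤v)
  chain-comparable u≤z z≤v (there (here refl))         (here refl)                 = inj₂ u≤z
  chain-comparable u≤z z≤v (there (here refl))         (there (here refl))         = inj₁ ≤.refl
  chain-comparable u≤z z≤v (there (here refl))         (there (there (here refl))) = inj₁ z≤v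
  chain-comparable u≤z z≤v (there (there (here refl))) (here refl)                 = inj₂ (≤.trans u≤z z≤v)
  chain-comparable u≤z z≤v (there (there (here refl))) (there (here refl))         = inj₂ z≤v
  chain-comparable u≤z z≤v (there (there (here refl))) (there (there (here refl))) = inj₁ ≤.refl

  Incomparable⇒≢ : ∀ {x y} → Incomparable _≤_ x y → x ≢ y
  Incomparable⇒≢ (x≰y , _) refl = x≰y ≤.refl

  △-convex-off : ∀ {S y u z v} → IC S → y ∉ₗ u ∷ z ∷ v ∷ [] →
    u ∈ S △ y → v ∈ S △ y → u ≤ z → z ≤ v → z ∈ S △ y
  △-convex-off ic y∉ u∈ v∈ u≤z z≤v =
    ∈-symDiff1⁺ z≢y (ic _ _ _ (∈-symDiff1⁻ u≢y u∈) (∈-symDiff1⁻ v≢y v∈) u≤z z≤v)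
    where
    u≢y = λ u≡y → y∉ (here (sym u≡y))
    z≢y = λ z≡y → y∉ (there (here (sym z≡y)))
    v≢y = λ v≡y → y∉ (there (there (here (sym v≡y))))

  IC-△-△ : ∀ {x y} J → IC (J △ x) → IC (J △ y) → Incomparable _≤_ x y → IC (J △ x △ y)
  IC-△-△ {x} {y} J ic-x ic-y x∥y u v z u∈ v∈ u≤z z≤v with y ∈ₗ? u ∷ z ∷ v ∷ []
  ... | no y∉ = △-convex-off ic-x y∉ u∈ v∈ u≤z z≤v
  ... | yes y∈ with x ∈ₗ? u ∷ z ∷ v ∷ []
  ...   | yes x∈ = ⊥-elim (Sum.[ proj₁ x∥y , proj₂ x∥y ] (chain-comparable u≤z z≤v x∈ y∈))
  ...   | no x∉ = subst (z ∈_) (sym swap-△)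
                    (△-convex-off ic-y x∉ (subst (u ∈_) swap-△ u∈) (subst (v ∈_) swap-△ v∈) u≤z z≤v)
    where
    swap-△ : J △ x △ y ≡ J △ y △ x
    swap-△ = symDiff1-comm J (Incomparable⇒≢ (swap x∥y))

  -- Otherwise IC-△-△ at J △ x, toggling x back, would make J △ y interval-closed.
  toggle-reject-after-accept : ∀ {x y} J → IC J → Incomparable _≤_ x y →
    IC (J △ x) → ¬ IC (J △ y) → ¬ IC (J △ x △ y)
  toggle-reject-after-accept {x} {y} J ic x∥y ic-x ¬ic-y ic-xy =
    ¬ic-y (subst IC J△x△y△x≡J△y
      (IC-△-△ (J △ x) ic-xy (subst IC (sym (symDiff1-involutive x J)) ic) (swap x∥y)))
    where
    open ≡-Reasoning
    J△x△y△x≡J△y : J △ x △ y △ x ≡ J △ y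
    J△x△y△x≡J△y = begin
      J △ x △ y △ x ≡⟨ symDiff1-comm (J △ x) (Incomparable⇒≢ x∥y) ⟩
      J △ x △ x △ y ≡⟨ cong (_△ y) (symDiff1-involutive x J) ⟩
      J △ y         ∎

  toggle-accept-reject-comm : ∀ {x y} J → IC J → Incomparable _≤_ x y →
    IC (J △ x) → ¬ IC (J △ y) → t x (t y J) ≡ t y (t x J)
  toggle-accept-reject-comm {x} {y} J ic x∥y ic-x ¬ic-y = begin
    t x (t y J)   ≡⟨ cong (t x) (toggle-reject y J ¬ic-y) ⟩
    t x J         ≡⟨ toggle-accept x J ic-x ⟩
    J △ x         ≡⟨ toggle-reject y (J △ x) (toggle-reject-after-accept J ic x∥y ic-x ¬ic-y) ⟨
    t y (J △ x)   ≡⟨ cong (t y) (toggle-accept x J ic-x) ⟨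
    t y (t x J)   ∎
    where open ≡-Reasoning

  toggle-comm : ∀ {x y J} → IC J → Incomparable _≤_ x y → t x (t y J) ≡ t y (t x J)
  toggle-comm {x} {y} {J} ic x∥y = by-cases (isIC? P (J △ x)) (isIC? P (J △ y))
    where
    open ≡-Reasoning
    by-cases : Dec (IC (J △ x)) → Dec (IC (J △ y)) → t x (t y J) ≡ t y (t x J)
    by-cases (yes ic-x) (yes ic-y) = begin
      t x (t y J)   ≡⟨ cong (t x) (toggle-accept y J ic-y) ⟩
      t x (J △ y)   ≡⟨ toggle-accept x (J △ y) (IC-△-△ J ic-y ic-x (swap x∥y)) ⟩
      J △ y △ x     ≡⟨ symDiff1-comm J (Incomparable⇒≢ x∥y) ⟩
      J △ x △ y     ≡⟨ toggle-accept y (J △ x) (IC-△-△ J ic-x ic-y x∥y) ⟨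
      t y (J △ x)   ≡⟨ cong (t y) (toggle-accept x J ic-x) ⟨
      t y (t x J)   ∎
    by-cases (yes ic-x) (no ¬ic-y) = toggle-accept-reject-comm J ic x∥y ic-x ¬ic-y
    by-cases (no ¬ic-x) (yes ic-y) = sym (toggle-accept-reject-comm J ic (swap x∥y) ic-y ¬ic-x)
    by-cases (no ¬ic-x) (no ¬ic-y) = begin
      t x (t y J)   ≡⟨ cong (t x) (toggle-reject y J ¬ic-y) ⟩
      t x J         ≡⟨ toggle-reject x J ¬ic-x ⟩
      J             ≡⟨ toggle-reject y J ¬ic-y ⟨
      t y J         ≡⟨ cong (t y) (toggle-reject x J ¬ic-x) ⟨
      t y (t x J)   ∎

  open PartiallyCommutingInvolutions _≤_ ≤.refl IC t toggle-preserves-IC toggle-involutive toggle-comm public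

AllPairs-reverse⁺ : ∀ {A : Set} {R : A → A → Set} {xs} →
  AllPairs R xs → AllPairs (λ a b → R b a) (reverse xs)
AllPairs-reverse⁺ []                     = []
AllPairs-reverse⁺ {xs = x ∷ xs} (Rx ∷ Rxs) = subst (AllPairs _) (sym (unfold-reverse x xs))
  (AllPairs.++⁺ (AllPairs-reverse⁺ Rxs) ([] ∷ [])
    (All.tabulate λ y∈ → All.lookup Rx (Any.reverse⁻ y∈) ∷ []))

enumeration : ∀ {P} → LinearExtension P → List (Fin (n P))
enumeration {P} L = map (enum L) (allFin (n P))

enumeration-ascending : ∀ {P} (L : LinearExtension P) →
  AllPairs (λ a b → ¬ _≼_ P b a) (enumeration L)
enumeration-ascending L = subst (AllPairs _) (sym (map-tabulate (λ i → i) (enum L)))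
  (AllPairs.tabulate⁺-< λ {i} {j} i<j xⱼ≼xᵢ → <⇒≱ i<j (mono L j i xⱼ≼xᵢ))

∈-enumeration : ∀ {P} (L : LinearExtension P) x → x ∈ₗ enumeration L
∈-enumeration L x with proj₂ (bij L) x
... | i , enum-i≡x = subst (x ∈ₗ_) (sym (map-tabulate (λ i → i) (enum L)))
  (subst (_∈ₗ tabulate (enum L)) (enum-i≡x refl) (∈-tabulate⁺ i))

Row-dual≡foldr-reverse : ∀ P (L : LinearExtension P) (L* : LinearExtension (dual P)) {J} →
  IsIC P J → Row (dual P) L* J ≡ foldr (toggle P) J (reverse (enumeration L))
Row-dual≡foldr-reverse P L L* {J} ic = begin
  Row (dual P) L* J                            ≡⟨ foldr-cong (λ x J → sym (toggle-dual P x J)) refl (enumeration L*) ⟩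
  foldr (toggle P) J (enumeration L*)          ≡⟨ foldr-Descending-unique (enumeration L*) (reverse (enumeration L))
                                                    (enumeration-ascending L*) (AllPairs-reverse⁺ (enumeration-ascending L))
                                                    (λ {x} _ → Any.reverse⁺ (∈-enumeration L x)) (λ {x} _ → ∈-enumeration L* x) ic ⟩
  foldr (toggle P) J (reverse (enumeration L)) ∎
  where
  open ≡-Reasoning
  open Toggles P

proposition2p13 : (P : FinPoset) (I : Subset (n P)) → IsIC P I →
    (IsIC (dual P) I × (∀ (x : Fin (n P)) → toggle P x I ≡ toggle (dual P) x I))
    × ((L : LinearExtension P) (L* : LinearExtension (dual P)) →
        IsIC P (Row (dual P) L* I) ×
        (Row P L (Row (dual P) L* I) ≡ I) × (Row (dual P) L* (Row P L I) ≡ I))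
proposition2p13 P I ic = (IsIC-dual {P} ic , λ x → toggle-dual P x I) , λ L L* →
  let l = enumeration L
      t = toggle P
  in  subst (IsIC P) (sym (Row-dual≡foldr-reverse P L L* ic)) (foldr-preserves-Inv (reverse l) ic)
    , (begin
        Row P L (Row (dual P) L* I)         ≡⟨ cong (Row P L) (Row-dual≡foldr-reverse P L L* ic) ⟩
        foldr t (foldr t I (reverse l)) l   ≡⟨ foldr-++ t I l (reverse l) ⟨
        foldr t I (l ++ reverse l)          ≡⟨ foldr-++-reverse l ic ⟩
        I                                   ∎)
    , (begin
        Row (dual P) L* (Row P L I)         ≡⟨ Row-dual≡foldr-reverse P L L* (foldr-preserves-Inv l ic) ⟩
        foldr t (foldr t I l) (reverse l)   ≡⟨ foldr-++ t I (reverse l) l ⟨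
        foldr t I (reverse l ++ l)          ≡⟨ cong (foldr t I ∘ (reverse l ++_)) (reverse-involutive l) ⟨
        foldr t I (reverse l ++ reverse (reverse l)) ≡⟨ foldr-++-reverse (reverse l) ic ⟩
        I                                   ∎)
  where
  open ≡-Reasoning
  open Toggles P
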